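{- For all $\Gamma\subseteq For$ and $\alpha,\beta\in For$: if $\Gamma\cup\{\alpha\}\vDash^{\mathbb{P}}_{G_3}\beta$, then $\Gamma\vDash^{\mathbb{P}}_{G_3}\alpha\rightarrow\beta$.
   Context: $For$ is the set of formulas built from a countable set $Prop$ of propositional letters with $\neg,\vee,\wedge,\rightarrow$. $G_3$ (Gödel) is given by the matrix with truth values $\{0,1/2,1\}$, designated set $\{1\}$, $f_\neg(0)=1$ and $f_\neg(x)=0$ for $x\neq 0$, $f_\vee=\max$, $f_\wedge=\min$, $f_\rightarrow(x,y)=1$ if $x\le y$ and $=y$ if $x>y$; valuations are maps $Prop\to\{0,1/2,1\}$ extended via these functions. $\Gamma\vDash_{G_3}\alpha$ iff every valuation giving all members of $\Gamma$ value $1$ gives $\alpha$ value $1$; $\Gamma$ is $G_3$-consistent iff $\{\alpha:\Gamma\vDash_{G_3}\alpha\}\neq For$. $\Gamma\vDash^{\mathbb{P}}_{G_3}\alpha$ iff there exists a $G_3$-consistent $\Gamma'\subseteq\Gamma$ with $\Gamma'\vDash_{G_3}\alpha$. -}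

module Defs where

open import Data.Nat using (ℕ)
open import Data.Product using (Σ; _×_)
open import Data.Sum using (_⊎_)
open import Relation.Nullary using (¬_)
open import Relation.Binary.PropositionalEquality using (_≡_)

data For : Set where
  var  : ℕ → For
  ¬'_  : For → For
  _∨'_ : For → For → For
  _∧'_ : For → For → For
  _⇒'_ : For → For → For

-- Truth values {0, 1/2, 1}
data V3 : Set where
  v0 vh v1 : V3

f¬ : V3 → V3
f¬ v0 = v1
f¬ _  = v0

max3 : V3 → V3 → V3
max3 v0 y  = y
max3 vh v1 = v1
max3 vh _  = vh
max3 v1 _  = v1

min3 : V3 → V3 → V3
min3 v0 _  = v0
min3 vh v0 = v0
min3 vh _  = vh
min3 v1 y  = y

f⇒ : V3 → V3 → V3
f⇒ v0 _  = v1
f⇒ vh v0 = v0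
f⇒ vh _  = v1
f⇒ v1 y  = y

Valuation : Set
Valuation = ℕ → V3

⟦_⟧ : For → Valuation → V3
⟦ var p ⟧   v = v p
⟦ ¬' a ⟧    v = f¬ (⟦ a ⟧ v)
⟦ a ∨' b ⟧  v = max3 (⟦ a ⟧ v) (⟦ b ⟧ v)
⟦ a ∧' b ⟧  v = min3 (⟦ a ⟧ v) (⟦ b ⟧ v)
⟦ a ⇒' b ⟧  v = f⇒ (⟦ a ⟧ v) (⟦ b ⟧ v)

FSet : Set₁
FSet = For → Set

_⊆_ : FSet → FSet → Set
Γ ⊆ Δ = ∀ φ → Γ φ → Δ φ

_,,_ : FSet → For → FSet
(Γ ,, α) φ = Γ φ ⊎ φ ≡ α

_⊨G3_ : FSet → For → Set
Γ ⊨G3 α = ∀ (v : Valuation) → (∀ φ → Γ φ → ⟦ φ ⟧ v ≡ v1) → ⟦ α ⟧ v ≡ v1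

G3-consistent : FSet → Set
G3-consistent Γ = ¬ (∀ φ → Γ ⊨G3 φ)

_⊨P_ : FSet → For → Set₁
Γ ⊨P α = Σ FSet (λ Γ' → (Γ' ⊆ Γ) × (G3-consistent Γ' × (Γ' ⊨G3 α)))

{-# OPTIONS --safe #-}
module Submission where

open import Defs
open import Function using (_∘_)
open import Data.Product using (_×_; _,_; proj₁; proj₂)
open import Data.Sum using (inj₁; inj₂)
open import Relation.Binary.PropositionalEquality using (_≡_; refl; trans; cong; module ≡-Reasoning)

-- If a consistent Γ' ⊆ Γ ∪ {α} entails β, then Γ' ∩ Γ is consistent (a subset
-- of Γ') and Γ' ⊆ (Γ' ∩ Γ) ∪ {α}, so the deduction theorem of G₃ gives
-- Γ' ∩ Γ ⊨ α → β.  The deduction theorem can fail only where ⟦ α ⟧ = 1/2 and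
-- ⟦ β ⟧ = 0; collapsing 1/2 to 1 is a homomorphism of G₃ onto its Boolean
-- reduct, and the collapsed valuation makes Γ ∪ {α} true but β false.

collapse : V3 → V3
collapse v0 = v0
collapse vh = v1
collapse v1 = v1

f¬-collapse : ∀ x → f¬ (collapse x) ≡ collapse (f¬ x)
f¬-collapse v0 = refl
f¬-collapse vh = refl
f¬-collapse v1 = refl

max3-collapse : ∀ x y → max3 (collapse x) (collapse y) ≡ collapse (max3 x y)
max3-collapse v0 y  = refl
max3-collapse vh v0 = refl
max3-collapse vh vh = refl
max3-collapse vh v1 = refl
max3-collapse v1 y  = refl

min3-collapse : ∀ x y → min3 (collapse x) (collapse y) ≡ collapse (min3 x y)
min3-collapse v0 y  = refl
min3-collapse vh v0 = refl
min3-collapse vh vh = refl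
min3-collapse vh v1 = refl
min3-collapse v1 y  = refl

f⇒-collapse : ∀ x y → f⇒ (collapse x) (collapse y) ≡ collapse (f⇒ x y)
f⇒-collapse v0 y  = refl
f⇒-collapse vh v0 = refl
f⇒-collapse vh vh = refl
f⇒-collapse vh v1 = refl
f⇒-collapse v1 y  = refl

⟦⟧-collapse : ∀ φ v → ⟦ φ ⟧ (collapse ∘ v) ≡ collapse (⟦ φ ⟧ v)
⟦⟧-collapse (var p)  v = refl
⟦⟧-collapse (¬' a)   v rewrite ⟦⟧-collapse a v = f¬-collapse (⟦ a ⟧ v)
⟦⟧-collapse (a ∨' b) v rewrite ⟦⟧-collapse a v | ⟦⟧-collapse b v = max3-collapse (⟦ a ⟧ v) (⟦ b ⟧ v)
⟦⟧-collapse (a ∧' b) v rewrite ⟦⟧-collapse a v | ⟦⟧-collapse b v = min3-collapse (⟦ a ⟧ v) (⟦ b ⟧ v)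
⟦⟧-collapse (a ⇒' b) v rewrite ⟦⟧-collapse a v | ⟦⟧-collapse b v = f⇒-collapse (⟦ a ⟧ v) (⟦ b ⟧ v)

f⇒-designated : ∀ x y → (x ≡ v1 → y ≡ v1) → (collapse x ≡ v1 → collapse y ≡ v1) → f⇒ x y ≡ v1
f⇒-designated v0 y  _   _         = refl
f⇒-designated vh v0 _   collapsed with collapsed refl
... | ()
f⇒-designated vh vh _   _         = refl
f⇒-designated vh v1 _   _         = refl
f⇒-designated v1 y  sat _         = sat refl

⊨G3-mono : ∀ {Γ Δ α} → Γ ⊆ Δ → Γ ⊨G3 α → Δ ⊨G3 α
⊨G3-mono Γ⊆Δ Γ⊨α v Δ-sat = Γ⊨α v (λ φ φ∈Γ → Δ-sat φ (Γ⊆Δ φ φ∈Γ))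

G3-consistent-anti : ∀ {Γ Δ} → Γ ⊆ Δ → G3-consistent Δ → G3-consistent Γ
G3-consistent-anti Γ⊆Δ Δ-cons Γ⊨all = Δ-cons (λ φ → ⊨G3-mono {α = φ} Γ⊆Δ (Γ⊨all φ))

_∩_ : FSet → FSet → FSet
(Γ ∩ Δ) φ = Γ φ × Δ φ

⊆-,,-∩ : ∀ {Γ Δ α} → Δ ⊆ (Γ ,, α) → Δ ⊆ ((Δ ∩ Γ) ,, α)
⊆-,,-∩ Δ⊆Γα φ φ∈Δ with Δ⊆Γα φ φ∈Δ
... | inj₁ φ∈Γ = inj₁ (φ∈Δ , φ∈Γ)
... | inj₂ φ≡α = inj₂ φ≡α

_Satisfies_ : Valuation → FSet → Set
v Satisfies Γ = ∀ φ → Γ φ → ⟦ φ ⟧ v ≡ v1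

satisfies-,, : ∀ {v Γ α} → v Satisfies Γ → ⟦ α ⟧ v ≡ v1 → v Satisfies (Γ ,, α)
satisfies-,, Γ-sat α-sat φ (inj₁ φ∈Γ) = Γ-sat φ φ∈Γ
satisfies-,, Γ-sat α-sat φ (inj₂ refl) = α-sat

satisfies-collapse : ∀ {v Γ} → v Satisfies Γ → (collapse ∘ v) Satisfies Γ
satisfies-collapse {v} Γ-sat φ φ∈Γ = trans (⟦⟧-collapse φ v) (cong collapse (Γ-sat φ φ∈Γ))

deduction : ∀ {Γ α β} → (Γ ,, α) ⊨G3 β → Γ ⊨G3 (α ⇒' β)
deduction {Γ} {α} {β} Γα⊨β v Γ-sat =
  f⇒-designated (⟦ α ⟧ v) (⟦ β ⟧ v) at-v at-collapse-v
  where
  open ≡-Reasoning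

  at-v : ⟦ α ⟧ v ≡ v1 → ⟦ β ⟧ v ≡ v1
  at-v α-sat = Γα⊨β v (satisfies-,, Γ-sat α-sat)

  at-collapse-v : collapse (⟦ α ⟧ v) ≡ v1 → collapse (⟦ β ⟧ v) ≡ v1
  at-collapse-v α-sat = begin
    collapse (⟦ β ⟧ v)   ≡⟨ ⟦⟧-collapse β v ⟨
    ⟦ β ⟧ (collapse ∘ v) ≡⟨ Γα⊨β (collapse ∘ v) sat ⟩
    v1                   ∎
    where
    sat : (collapse ∘ v) Satisfies (Γ ,, α)
    sat = satisfies-,, (satisfies-collapse Γ-sat) (trans (⟦⟧-collapse α v) α-sat)

proposition20 : (Γ : FSet) (α β : For) → (Γ ,, α) ⊨P β → Γ ⊨P (α ⇒' β)
proposition20 Γ α β (Γ' , Γ'⊆Γα , Γ'-cons , Γ'⊨β) =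
  Γ' ∩ Γ , (λ _ → proj₂) , G3-consistent-anti (λ _ → proj₁) Γ'-cons ,
  deduction {β = β} (⊨G3-mono {α = β} (⊆-,,-∩ Γ'⊆Γα) Γ'⊨β)
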